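{- For any state predicate $U$, statement $s$ and setoid trace predicate $P$, if $\vdash\{U\}\,s\,\{P\}$ is derivable in the trace-based Hoare logic, then $\vdash\{U\}\,s\,\{\langle U\rangle\ast\ast P\}$ is derivable.
   Context: While statements: $s ::= x:=e \mid \mathsf{skip}\mid s_0;s_1\mid \mathsf{if}\ e\ \mathsf{then}\ s_t\ \mathsf{else}\ s_f\mid \mathsf{while}\ e\ \mathsf{do}\ s_t$, with $x$ integer variables and $e$ arithmetic expressions; a state $\sigma$ assigns integers to variables, $[\![e]\!]\sigma$ is the value, $\sigma\models e$ means $e$ is true in $\sigma$ (so $e$, $\neg e$ are state predicates). Traces are coinductive: $\langle\sigma\rangle$, and $\sigma::\tau$ for a trace $\tau$; bisimilarity $\approx$ is coinductive ($\langle\sigma\rangle\approx\langle\sigma\rangle$; $\sigma::\tau\approx\sigma::\tau'$ if $\tau\approx\tau'$); $\mathit{hd}\langle\sigma\rangle=\mathit{hd}(\sigma::\tau)=\sigma$. State predicates are arbitrary; trace predicates are setoid predicates (invariant under $\approx$); connectives $\wedge,\neg,\exists$ are pointwise; $\models$ is entailment. $\langle U\rangle$ holds exactly of $\langle\sigma\rangle$ with $\sigma\models U$; $\mathrm{dup}(U)$ exactly of $\sigma::\langle\sigma\rangle$ with $\sigma\models U$; $U[x\mapsto e]$ exactly of $\sigma::\langle\sigma[x\mapsto[\![e]\!]\sigma]\rangle$ with $\sigma\models U$. $\mathrm{follows}_Q(\tau,\tau')$ is coinductive: $\mathrm{follows}_Q(\langle\sigma\rangle,\tau)$ if $\mathit{hd}\,\tau=\sigma$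 and $\tau\models Q$; $\mathrm{follows}_Q(\sigma::\tau,\sigma::\tau')$ if $\mathrm{follows}_Q(\tau,\tau')$. $\tau'\models P\ast\ast Q$ iff $\exists\tau$, $\tau\models P$ and $\mathrm{follows}_Q(\tau,\tau')$ (chains associate to the right). $P^{\dagger}$ is coinductive: $\tau\models P^{\dagger}$ if $\tau\models\langle\mathsf{true}\rangle$; $\tau'\models P^{\dagger}$ if $\exists\tau$, $\tau\models P$ and $\mathrm{follows}_{P^{\dagger}}(\tau,\tau')$. The trace-based Hoare logic derives judgements $\{U\}\,s\,\{P\}$ inductively by: $\{U\}\,x:=e\,\{U[x\mapsto e]\}$; $\{U\}\,\mathsf{skip}\,\{\langle U\rangle\}$; from $\{U\}\,s_0\,\{P\ast\ast\langle V\rangle\}$ and $\{V\}\,s_1\,\{Q\}$ infer $\{U\}\,s_0;s_1\,\{P\ast\ast Q\}$; from $\{e\wedge U\}\,s_t\,\{P\}$ and $\{\neg e\wedge U\}\,s_f\,\{P\}$ infer $\{U\}\,\mathsf{if}\ e\ \mathsf{then}\ s_t\ \mathsf{else}\ s_f\,\{\mathrm{dup}(U)\ast\ast P\}$; from $U\models I$ and $\{e\wedge I\}\,s_t\,\{P\ast\ast\langle I\rangle\}$ infer $\{U\}\,\mathsf{while}\ e\ \mathsf{do}\ s_t\,\{\mathrm{dup}(U)\ast\ast(P\ast\ast\mathrm{dup}(I))^{\dagger}\ast\ast\langle\neg e\rangle\}$; from $U\models U'$, $\{U'\}\,s\,\{P'\}$, $P'\models P$ infer $\{U\}\,s\,\{P\}$;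 from $\forall z.\ \{U_z\}\,s\,\{P_z\}$ infer $\{\exists z.U_z\}\,s\,\{\exists z.P_z\}$. -}

module Defs where

open import Level using (Lift; lift; lower) renaming (suc to lsuc; zero to lzero)
open import Data.Nat using (ℕ; zero; suc; _≟_)
open import Data.Integer using (ℤ; _+_; _-_; _*_) renaming (0ℤ to 0ℤ)
open import Data.Maybe using (Maybe; just; nothing)
open import Data.Product using (Σ; _×_; _,_; proj₁; proj₂; Σ-syntax)
open import Data.Sum using (_⊎_; inj₁; inj₂)
open import Data.Bool using (if_then_else_)
open import Data.Unit using (⊤)
open import Relation.Nullary using (¬_; does)
open import Relation.Binary.PropositionalEquality
  using (_≡_; refl; sym; trans; cong; subst)

Var : Set
Var = ℕ

data Expr : Set where
  var  : Var → Expr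
  lit  : ℤ → Expr
  _⊕_  : Expr → Expr → Expr
  _⊖_  : Expr → Expr → Expr
  _⊗_  : Expr → Expr → Expr

data Stmt : Set where
  _≔_         : Var → Expr → Stmt
  skip        : Stmt
  _︔_         : Stmt → Stmt → Stmt
  ifS_then_else_ : Expr → Stmt → Stmt → Stmt
  whileS_loop_   : Expr → Stmt → Stmt

State : Set
State = Var → ℤ

⟦_⟧ : Expr → State → ℤ
⟦ var x ⟧ σ = σ x
⟦ lit n ⟧ σ = n
⟦ e ⊕ f ⟧ σ = ⟦ e ⟧ σ + ⟦ f ⟧ σ
⟦ e ⊖ f ⟧ σ = ⟦ e ⟧ σ - ⟦ f ⟧ σ
⟦ e ⊗ f ⟧ σ = ⟦ e ⟧ σ * ⟦ f ⟧ σ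

_[_↦_] : State → Var → ℤ → State
(σ [ x ↦ v ]) y = if does (y ≟ x) then v else σ y

-- σ ⊨ e : the expression e is true in σ (convention: nonzero value)
_⊨ₑ_ : State → Expr → Set
σ ⊨ₑ e = ¬ (⟦ e ⟧ σ ≡ 0ℤ)

SPred : Set₁
SPred = State → Set

_⊨ˢ_ : SPred → SPred → Set
U ⊨ˢ V = ∀ σ → U σ → V σ

_∧ₑ_ : Expr → SPred → SPred
(e ∧ₑ U) σ = (σ ⊨ₑ e) × U σ

_∧¬ₑ_ : Expr → SPred → SPred
(e ∧¬ₑ U) σ = ¬ (σ ⊨ₑ e) × U σ

⌜_⌝ : Expr → SPred
⌜ e ⌝ σ = σ ⊨ₑ e

⌜¬_⌝ : Expr → SPred
⌜¬ e ⌝ σ = ¬ (σ ⊨ₑ e)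

ttˢ : SPred
ttˢ _ = ⊤

∃ˢ : {Z : Set} → (Z → SPred) → SPred
∃ˢ {Z} U σ = Σ Z (λ z → U z σ)

-- Traces: nonempty, possibly infinite sequences of states.
-- hd is the first state; tl n is the (n+1)-st state, if any; once the
-- trace has ended it stays ended.

record Trace : Set where
  constructor mkTr
  field
    hd     : State
    tl     : ℕ → Maybe State
    closed : ∀ n → tl n ≡ nothing → tl (suc n) ≡ nothing
open Trace public

-- the tail of τ, given that its second state is σ  (τ = hd τ :: shift τ σ)
shift : Trace → State → Trace
shift τ σ = mkTr σ (λ n → tl τ (suc n)) (λ n → closed τ (suc n))

-- bisimilarity (for sequence-encoded traces: agreement at every position)
_≈_ : Trace → Trace → Set
τ ≈ τ' = (hd τ ≡ hd τ') × (∀ n → tl τ n ≡ tl τ' n)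

≈-refl : ∀ {τ} → τ ≈ τ
≈-refl = refl , λ _ → refl

≈-sym : ∀ {τ τ'} → τ ≈ τ' → τ' ≈ τ
≈-sym (h , t) = sym h , λ n → sym (t n)

≈-trans : ∀ {τ τ' τ''} → τ ≈ τ' → τ' ≈ τ'' → τ ≈ τ''
≈-trans (h , t) (h' , t') = trans h h' , λ n → trans (t n) (t' n)

record TPred : Set₂ where
  field
    pred : Trace → Set₁
    resp : ∀ {τ τ'} → τ ≈ τ' → pred τ → pred τ'
open TPred public

_⊨ᵗ_ : TPred → TPred → Set₁
P ⊨ᵗ Q = ∀ τ → pred P τ → pred Q τ

∃ᵗ : {Z : Set} → (Z → TPred) → TPred
∃ᵗ {Z} P = record
  { pred = λ τ → Σ Z (λ z → pred (P z) τ)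
  ; resp = λ eq (z , p) → z , resp (P z) eq p }

⟨_⟩ : SPred → TPred
⟨ U ⟩ = record
  { pred = λ τ → Lift (lsuc lzero) (U (hd τ) × tl τ 0 ≡ nothing)
  ; resp = λ { (h , t) (lift (u , e)) → lift (subst U h u , trans (sym (t 0)) e) } }

dup : SPred → TPred
dup U = record
  { pred = λ τ → Lift (lsuc lzero)
                   (U (hd τ) × tl τ 0 ≡ just (hd τ) × tl τ 1 ≡ nothing)
  ; resp = λ { {τ} {τ'} (h , t) (lift (u , e₀ , e₁)) →
               lift ( subst U h u
                    , trans (sym (t 0)) (trans e₀ (cong just h))
                    , trans (sym (t 1)) e₁ ) } }

_[_≔ᵗ_] : SPred → Var → Expr → TPred
U [ x ≔ᵗ e ] = record
  { pred = λ τ → Lift (lsuc lzero)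
                   (U (hd τ) × tl τ 0 ≡ just (hd τ [ x ↦ ⟦ e ⟧ (hd τ) ]) × tl τ 1 ≡ nothing)
  ; resp = λ { {τ} {τ'} (h , t) (lift (u , e₀ , e₁)) →
               lift ( subst U h u
                    , trans (sym (t 0)) (trans e₀ (cong (λ σ → just (σ [ x ↦ ⟦ e ⟧ σ ])) h))
                    , trans (sym (t 1)) e₁ ) } }

-- follows_Q (coinductive), as a greatest fixed point.
-- One unfolding step:
--   follows_Q(⟨σ⟩, τ')        if hd τ' = σ and τ' ⊨ Q
--   follows_Q(σ::τ, σ::τ'')   if follows_Q(τ, τ'')

FollowsStep : (Trace → Set₁) → (Trace → Trace → Set) → Trace → Trace → Set₁
FollowsStep Q R τ τ' =
    (tl τ 0 ≡ nothing × hd τ' ≡ hd τ × Q τ')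
  ⊎ (hd τ ≡ hd τ' × Σ[ σ ∈ State ] Σ[ σ' ∈ State ]
       (tl τ 0 ≡ just σ × tl τ' 0 ≡ just σ' × R (shift τ σ) (shift τ' σ')))

Follows : (Trace → Set₁) → Trace → Trace → Set₁
Follows Q τ τ' =
  Σ[ R ∈ (Trace → Trace → Set) ]
    ((∀ {a b} → R a b → FollowsStep Q R a b) × R τ τ')

follows-map : ∀ {Q Q' : Trace → Set₁} →
  (∀ {b c} → b ≈ c → Q b → Q' c) →
  ∀ {τ b c} → Follows Q τ b → b ≈ c → Follows Q' τ c
follows-map {Q} {Q'} f (R , post , r) bc = R' , post' , (_ , r , bc)
  where
  R' : Trace → Trace → Set
  R' a c = Σ[ b ∈ Trace ] (R a b × b ≈ c)
  post' : ∀ {a c} → R' a c → FollowsStep Q' R' a c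
  post' (b , r , bc) with post r
  ... | inj₁ (e , h , q) = inj₁ (e , trans (sym (proj₁ bc)) h , f bc q)
  ... | inj₂ (h , σ , σ' , e , e' , r') =
        inj₂ (trans h (proj₁ bc) , σ , σ' , e , trans (sym (proj₂ bc 0)) e'
             , (_ , r' , (refl , λ n → proj₂ bc (suc n))))

_**_ : TPred → TPred → TPred
P ** Q = record
  { pred = λ τ' → Σ[ τ ∈ Trace ] (pred P τ × Follows (pred Q) τ τ')
  ; resp = λ eq (τ , p , fo) → τ , p , follows-map (resp Q) fo eq }
infixr 5 _**_

-- P† (coinductive), as a greatest fixed point.
--   τ ⊨ P†   if τ ⊨ ⟨true⟩
--   τ' ⊨ P†  if ∃ τ. τ ⊨ P and follows_{P†}(τ, τ')

DagStep : TPred → (Trace → Set) → Trace → Set₁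
DagStep P X τ' =
    pred ⟨ ttˢ ⟩ τ'
  ⊎ Σ[ τ ∈ Trace ] (pred P τ × Follows (λ t → Lift (lsuc lzero) (X t)) τ τ')

Dag : TPred → Trace → Set₁
Dag P τ' = Σ[ X ∈ (Trace → Set) ] ((∀ {t} → X t → DagStep P X t) × X τ')

dag-resp : ∀ P {τ τ'} → τ ≈ τ' → Dag P τ → Dag P τ'
dag-resp P {τ} eq (X , post , x) = X' , post' , (τ , x , eq)
  where
  X' : Trace → Set
  X' c = Σ[ b ∈ Trace ] (X b × b ≈ c)
  post' : ∀ {c} → X' c → DagStep P X' c
  post' {c} (b , x , bc) with post x
  ... | inj₁ l = inj₁ (resp ⟨ ttˢ ⟩ {b} {c} bc l)
  ... | inj₂ (τ₀ , p , fo) =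
        inj₂ (τ₀ , p , follows-map (λ {b₁} eq₁ (lift x₁) → lift (b₁ , x₁ , eq₁)) fo bc)

_† : TPred → TPred
P † = record { pred = Dag P ; resp = dag-resp P }

data ⊢[_]_[_] : SPred → Stmt → TPred → Set₂ where
  assign : ∀ {U x e} → ⊢[ U ] (x ≔ e) [ U [ x ≔ᵗ e ] ]
  skip   : ∀ {U} → ⊢[ U ] skip [ ⟨ U ⟩ ]
  seq    : ∀ {U V s₀ s₁ P Q} →
           ⊢[ U ] s₀ [ P ** ⟨ V ⟩ ] → ⊢[ V ] s₁ [ Q ] →
           ⊢[ U ] (s₀ ︔ s₁) [ P ** Q ]
  if     : ∀ {U e sₜ s_f P} →
           ⊢[ e ∧ₑ U ] sₜ [ P ] → ⊢[ e ∧¬ₑ U ] s_f [ P ] →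
           ⊢[ U ] (ifS e then sₜ else s_f) [ dup U ** P ]
  while  : ∀ {U I e sₜ P} →
           U ⊨ˢ I → ⊢[ e ∧ₑ I ] sₜ [ P ** ⟨ I ⟩ ] →
           ⊢[ U ] (whileS e loop sₜ) [ dup U ** ((P ** dup I) †) ** ⟨ ⌜¬ e ⌝ ⟩ ]
  conseq : ∀ {U U' s P P'} →
           U ⊨ˢ U' → ⊢[ U' ] s [ P' ] → P' ⊨ᵗ P →
           ⊢[ U ] s [ P ]
  exists : ∀ {Z : Set} {U : Z → SPred} {s} {P : Z → TPred} →
           (∀ z → ⊢[ U z ] s [ P z ]) →
           ⊢[ ∃ˢ U ] s [ ∃ᵗ P ]

module Submission where

-- Write P ∧hd W for "P holds and the first state satisfies W".
-- Every trace satisfying P ∧hd U also satisfies ⟨U⟩ ** P: prefix it with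
-- the one-state trace ⟨hd τ⟩, which follows on to τ itself.  So it
-- suffices to show, by induction on derivations, the strengthening
--
--   ⊢ {U} s {P}  and  W ⊨ U   ⟹   ⊢ {W} s {P ∧hd W},
--
-- i.e. the precondition can be narrowed and recorded on the first state
-- of every trace in the postcondition.  The induction only needs that
-- `follows` preserves the first state, so ∧hd commutes with the left
-- factor of ** (lemmas **-∧hd-in and **-∧hd-out), plus the observation
-- that the atomic postconditions U[x↦e], ⟨U⟩, dup U record U on the first
-- state.  The theorem is the case W = U followed by the prefixing step.

open import Defs
open import Level using (Lift; lift) renaming (suc to lsuc; zero to lzero)
open import Data.Product using (_×_; _,_; proj₁; proj₂)
open import Data.Sum using (inj₁; inj₂)
open import Data.Maybe using (nothing)
open import Relation.Binary.PropositionalEquality using (_≡_; refl; sym; subst)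

⊨ˢ-refl : ∀ {U} → U ⊨ˢ U
⊨ˢ-refl σ u = u

_∧hd_ : TPred → SPred → TPred
P ∧hd W = record
  { pred = λ τ → pred P τ × Lift (lsuc lzero) (W (hd τ))
  ; resp = λ eq (p , lift w) → resp P eq p , lift (subst W (proj₁ eq) w) }

∧hd-mono : ∀ {P P' W} → P ⊨ᵗ P' → (P ∧hd W) ⊨ᵗ (P' ∧hd W)
∧hd-mono P⊨P' τ (p , w) = P⊨P' τ p , w

follows-hd : ∀ {Q τ τ'} → Follows Q τ τ' → hd τ ≡ hd τ'
follows-hd (R , post , r) with post r
... | inj₁ (_ , hd≡ , _) = sym hd≡
... | inj₂ (hd≡ , _)     = hd≡

**-∧hd-in : ∀ {P Q W} → ((P ** Q) ∧hd W) ⊨ᵗ ((P ∧hd W) ** Q)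
**-∧hd-in {W = W} τ' ((τ , p , fo) , lift w) =
  τ , (p , lift (subst W (sym (follows-hd fo)) w)) , fo

**-∧hd-out : ∀ {P Q W} → ((P ∧hd W) ** Q) ⊨ᵗ ((P ** Q) ∧hd W)
**-∧hd-out {W = W} τ' (τ , (p , lift w) , fo) =
  (τ , p , fo) , lift (subst W (follows-hd fo) w)

**-monoˡ : ∀ {P P' Q} → P ⊨ᵗ P' → (P ** Q) ⊨ᵗ (P' ** Q)
**-monoˡ P⊨P' τ' (τ , p , fo) = τ , P⊨P' τ p , fo

assign-∧hd : ∀ {U W x e} → W ⊨ˢ U → (W [ x ≔ᵗ e ]) ⊨ᵗ ((U [ x ≔ᵗ e ]) ∧hd W)
assign-∧hd W⊨U τ (lift (w , step , end)) = lift (W⊨U _ w , step , end) , lift w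

single-∧hd : ∀ {U W} → W ⊨ˢ U → ⟨ W ⟩ ⊨ᵗ (⟨ U ⟩ ∧hd W)
single-∧hd W⊨U τ (lift (w , end)) = lift (W⊨U _ w , end) , lift w

dup-∧hd : ∀ {U W} → W ⊨ˢ U → dup W ⊨ᵗ (dup U ∧hd W)
dup-∧hd W⊨U τ (lift (w , step , end)) = lift (W⊨U _ w , step , end) , lift w

dup-**-∧hd : ∀ {U W Q} → W ⊨ˢ U → (dup W ** Q) ⊨ᵗ ((dup U ** Q) ∧hd W)
dup-**-∧hd {U} {W} {Q} W⊨U τ' d =
  **-∧hd-out {dup U} {Q} {W} τ' (**-monoˡ {dup W} {dup U ∧hd W} {Q} (dup-∧hd W⊨U) τ' d)

∧ₑ-mono : ∀ {e U W} → W ⊨ˢ U → (e ∧ₑ W) ⊨ˢ (e ∧ₑ U)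
∧ₑ-mono W⊨U σ (c , w) = c , W⊨U σ w

∧¬ₑ-mono : ∀ {e U W} → W ⊨ˢ U → (e ∧¬ₑ W) ⊨ˢ (e ∧¬ₑ U)
∧¬ₑ-mono W⊨U σ (c , w) = c , W⊨U σ w

strengthen : ∀ {U s P} → ⊢[ U ] s [ P ] → ∀ W → W ⊨ˢ U → ⊢[ W ] s [ P ∧hd W ]
strengthen (assign {U} {x} {e}) W W⊨U =
  conseq ⊨ˢ-refl assign (assign-∧hd {U} {W} {x} {e} W⊨U)
strengthen (skip {U}) W W⊨U =
  conseq ⊨ˢ-refl skip (single-∧hd {U} {W} W⊨U)
strengthen (seq {V = V} {P = P} {Q = Q} d₀ d₁) W W⊨U =
  conseq ⊨ˢ-refl
    (seq {P = P ∧hd W} (conseq ⊨ˢ-refl (strengthen d₀ W W⊨U) (**-∧hd-in {P} {⟨ V ⟩} {W})) d₁)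
    (**-∧hd-out {P} {Q} {W})
-- The branch postconditions only keep P; W is recorded by dup W instead.
strengthen (if {U} {e} {P = P} dₜ d_f) W W⊨U =
  conseq ⊨ˢ-refl
    (if {P = P}
        (conseq ⊨ˢ-refl (strengthen dₜ (e ∧ₑ W) (∧ₑ-mono {e} {U} {W} W⊨U)) (λ τ → proj₁))
        (conseq ⊨ˢ-refl (strengthen d_f (e ∧¬ₑ W) (∧¬ₑ-mono {e} {U} {W} W⊨U)) (λ τ → proj₁)))
    (dup-**-∧hd {U} {W} {P} W⊨U)
strengthen (while {U} {I} {e} {sₜ} {P} U⊨I d) W W⊨U =
  conseq ⊨ˢ-refl
    (while {W} {I} {e} {sₜ} {P} (λ σ w → U⊨I σ (W⊨U σ w)) d)
    (dup-**-∧hd {U} {W} {((P ** dup I) †) ** ⟨ ⌜¬ e ⌝ ⟩} W⊨U)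
strengthen (conseq {P = P} {P' = P'} U⊨U' d P'⊨P) W W⊨U =
  conseq ⊨ˢ-refl (strengthen d W (λ σ w → U⊨U' σ (W⊨U σ w)))
    (∧hd-mono {P'} {P} {W} P'⊨P)
-- For ∃ z. U z, narrow each instance to W ∧ U z; the witness z is kept
-- and W is read off the first state.
strengthen (exists {U = U} ds) W W⊨U =
  conseq {U' = ∃ˢ (λ z σ → W σ × U z σ)}
    (λ σ w → proj₁ (W⊨U σ w) , w , proj₂ (W⊨U σ w))
    (exists (λ z → strengthen (ds z) (λ σ → W σ × U z σ) (λ σ → proj₂)))
    (λ τ (z , p , lift (w , _)) → (z , p) , lift w)

∧hd⇒single-** : ∀ U P → (P ∧hd U) ⊨ᵗ (⟨ U ⟩ ** P)
∧hd⇒single-** U P τ (p , lift u) = start , lift (u , refl) , R , post , refl , refl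
  where
  start : Trace
  start = mkTr (hd τ) (λ _ → nothing) (λ _ _ → refl)
  R : Trace → Trace → Set
  R a b = (a ≡ start) × (b ≡ τ)
  post : ∀ {a b} → R a b → FollowsStep (pred P) R a b
  post (refl , refl) = inj₁ (refl , refl , p)

lemma3p7 : ∀ (U : SPred) (s : Stmt) (P : TPred) →
    ⊢[ U ] s [ P ] → ⊢[ U ] s [ ⟨ U ⟩ ** P ]
lemma3p7 U s P d = conseq ⊨ˢ-refl (strengthen d U ⊨ˢ-refl) (∧hd⇒single-** U P)
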